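{- Let $P$ be a finite $\Gamma$-colored $d$-complete poset and assume $\Gamma$ is simply laced. Let $x<y$ in $P$ and suppose the interval $[x,y]$ is a chain. Then no two elements of $[x,y]$ have the same color.
   Context: Dynkin diagram $\Gamma$: finite set with integers $\theta_{ab}$, $\theta_{aa}=2$, $\theta_{ab}\le0$ ($a\ne b$), $\theta_{ab}=0\iff\theta_{ba}=0$; $a\sim b$ if $a\ne b$ and $\theta_{ab}<0$; simply laced: all $\theta_{ab}\in\{ -1,0,2\}$. $\Gamma$-colored poset: poset with surjective $\kappa:P\to\Gamma$. Consecutive elements of color $a$: $x<y$ of color $a$, no color-$a$ element in $(x,y)$. $U(x,P)=\{y>x:\kappa(y)\sim\kappa(x)\}$. $\Gamma$-colored $d$-complete: locally finite with (EC) equal colors comparable; (NA) neighbors (one covers the other) have adjacent colors; (AC) adjacent colors comparable; (ICE2) consecutive $x<y$ of color $a$ have $\sum_{z\in(x,y)}-\theta_{\kappa(z),a}=2$; (UCB1) for maximal $x$ of color $a$, $U(x,P)$ finite and $\sum_{y\in U(x,P)}-\theta_{\kappa(y),a}\le1$. -}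

module Defs where

open import Data.Nat using (ℕ)
open import Data.Fin using (Fin)
open import Data.Fin.Properties using () renaming (_≟_ to _≟ᶠ_)
open import Data.Integer using (ℤ; +_; -_; _+_; _<_; _≤_; -1ℤ; 0ℤ; 1ℤ)
open import Data.Integer.Properties using () renaming (_<?_ to _<?ℤ_)
open import Data.List using (List; filterᵇ; map; foldr; allFin)
open import Data.Bool using (Bool; _∧_; not)
open import Data.Product using (_×_; Σ; ∃)
open import Data.Sum using (_⊎_)
open import Relation.Nullary using (¬_; does)
open import Relation.Binary using (Decidable; IsPartialOrder)
open import Relation.Binary.PropositionalEquality using (_≡_; _≢_)

record Dynkin (m : ℕ) : Set where
  field
    θ       : Fin m → Fin m → ℤ
    θ-diag  : ∀ a → θ a a ≡ + 2
    θ-off   : ∀ a b → a ≢ b → θ a b ≤ 0ℤ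
    θ-zero  : ∀ a b → θ a b ≡ 0ℤ → θ b a ≡ 0ℤ   -- with a,b swapped gives the iff

  Adj : Fin m → Fin m → Set
  Adj a b = a ≢ b × θ a b < 0ℤ

  adjᵇ : Fin m → Fin m → Bool
  adjᵇ a b = not (does (a ≟ᶠ b)) ∧ does (θ a b <?ℤ 0ℤ)

SimplyLaced : ∀ {m} → Dynkin m → Set
SimplyLaced {m} Γ = ∀ (a b : Fin m) → θ a b ≡ -1ℤ ⊎ θ a b ≡ 0ℤ ⊎ θ a b ≡ + 2
  where open Dynkin Γ

-- A finite poset on Fin n (order decidable, automatic classically for finite posets)
record FinPoset (n : ℕ) : Set₁ where
  field
    _≼_       : Fin n → Fin n → Set
    isPO      : IsPartialOrder _≡_ _≼_
    _≼?_      : Decidable _≼_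

  _≺_ : Fin n → Fin n → Set
  x ≺ y = x ≼ y × x ≢ y

  ≺ᵇ : Fin n → Fin n → Bool
  ≺ᵇ x y = does (x ≼? y) ∧ not (does (x ≟ᶠ y))

  _⋖_ : Fin n → Fin n → Set
  x ⋖ y = x ≺ y × (∀ z → ¬ (x ≺ z × z ≺ y))

  Comparable : Fin n → Fin n → Set
  Comparable x y = x ≼ y ⊎ y ≼ x

sumℤ : List ℤ → ℤ
sumℤ = foldr _+_ 0ℤ

sumWhere : ∀ {n} → (Fin n → Bool) → (Fin n → ℤ) → ℤ
sumWhere {n} p f = sumℤ (map f (filterᵇ p (allFin n)))

-- Γ-colored d-complete poset structure on a finite poset (finite ⇒ locally finite,
-- and U(x,P) is automatically finite)
record ColoredDComplete {m n : ℕ} (Γ : Dynkin m) (P : FinPoset n) : Set where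
  open Dynkin Γ
  open FinPoset P
  field
    κ     : Fin n → Fin m
    κ-surj : ∀ a → ∃ λ x → κ x ≡ a
    EC    : ∀ x y → κ x ≡ κ y → Comparable x y
    NA    : ∀ x y → x ⋖ y → Adj (κ x) (κ y)
    AC    : ∀ x y → Adj (κ x) (κ y) → Comparable x y
    ICE2  : ∀ x y a → κ x ≡ a → κ y ≡ a → x ≺ y →
            (∀ z → κ z ≡ a → ¬ (x ≺ z × z ≺ y)) →
            sumWhere (λ z → ≺ᵇ x z ∧ ≺ᵇ z y) (λ z → - θ (κ z) a) ≡ + 2
    UCB1  : ∀ x a → κ x ≡ a → (∀ y → κ y ≡ a → ¬ (x ≺ y)) →
            sumWhere (λ y → ≺ᵇ x y ∧ adjᵇ (κ y) (κ x)) (λ y → - θ (κ y) a) ≤ 1ℤ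

-- Since Γ is simply laced, the weight −θ(κ z, a) of a point z not of colour a is 1 if κ z ∼ a and
-- 0 otherwise, so (ICE2) and (UCB1) become counting statements about neighbours of colour a.
-- Suppose u < v have the same colour a and [u, v] is a chain. By Noetherian induction no such pair
-- lies above u, and shrinking v we may take u, v consecutive of colour a. By (NA) v does not cover u,
-- and by (ICE2) the cover c of u in [u, v] is not the only point of (u, v); so c is covered by some
-- c₂ < v. Both v and c₂ lie above c with colours adjacent to b = κ c, so by (UCB1) some w > c has
-- colour b; take the least one. By (AC) w is comparable with v. If w < v, [c, w] is a chain of
-- colour b above u. If v < w, then c₂ and v use up the weight 2 of (c, w), so every point of (c, w)
-- adjacent to b is c₂ or v; since lower and upper covers inside (c, w) are adjacent to b, all of
-- (c, w) lies in [c₂, v], so again [c, w] is a chain of colour b above u.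
module Submission where

open import Defs
open import Data.Nat using (ℕ; z≤n; s≤s) renaming (_≤_ to _≤ℕ_)
open import Data.Fin using (Fin)
open import Data.Fin.Induction using (po-wellFounded; po-noetherian)
open import Data.Fin.Properties using (any?) renaming (_≟_ to _≟ᶠ_)
open import Data.Integer using (ℤ; +_; -_; _+_; _≤_; -1ℤ; 0ℤ; 1ℤ; +≤+; drop‿+≤+)
open import Data.Integer.Properties using (_<?_; ≤-refl; ≤-reflexive; ≤-trans; +-mono-≤; +-identityʳ; ≤∧≢⇒<; <-irrefl)
open import Data.List using (List; []; _∷_; filterᵇ; map; allFin; length)
open import Data.List.Properties using (filter-accept; filter-reject; filter-none)
open import Data.List.Membership.Propositional using (_∈_)
open import Data.List.Membership.Propositional.Properties using (∈-allFin)
open import Data.List.Relation.Unary.Any using (here; there)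
open import Data.List.Relation.Unary.All as All using (All; []; _∷_)
open import Data.List.Relation.Unary.AllPairs using ([]; _∷_)
open import Data.List.Relation.Unary.Unique.Propositional using (Unique)
open import Data.List.Relation.Unary.Unique.Propositional.Properties using (allFin⁺)
open import Data.Bool using (Bool; true; false; _∧_; not; T; T?)
open import Data.Bool.Properties using (T-∧; ∧-identityʳ)
open import Data.Unit using (tt)
open import Data.Product using (_×_; _,_; ∃; proj₁; proj₂; map₂; uncurry)
open import Data.Empty using (⊥)
open import Data.Product.Function.NonDependent.Propositional using (_×-⇔_)
open import Data.Sum using (_⊎_; inj₁; inj₂; [_,_]′)
open import Function using (_∘_; id; const; flip; _⇔_; mk⇔; Equivalence)
open import Function.Properties.Equivalence using () renaming (trans to ⇔-trans; refl to ⇔-refl)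
open import Relation.Nullary using (¬_; Dec; yes; no; does; contradiction)
open import Relation.Nullary.Decidable using (_×-dec_)
open import Relation.Unary using (Pred) renaming (Decidable to Decidable₁)
open import Relation.Binary using (Rel; Decidable; IsPartialOrder)
open import Relation.Binary.Definitions using (DecidableEquality)
import Relation.Binary.Construct.NonStrictToStrict as ToStrict
open import Induction.WellFounded using (WellFounded; Acc; acc)
open import Relation.Binary.PropositionalEquality using (_≡_; _≢_; refl; sym; trans; cong; subst; module ≡-Reasoning)
open import Algebra.Properties.CommutativeSemigroup Data.Integer.Properties.+-commutativeSemigroup using (x∙yz≈y∙xz)

open Equivalence using (to; from)

T-does : ∀ {a} {A : Set a} (A? : Dec A) → T (does A?) ⇔ A
T-does (yes a) = mk⇔ (const a) (const tt)
T-does (no ¬a) = mk⇔ (λ ()) ¬a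

T-not-does : ∀ {a} {A : Set a} (A? : Dec A) → T (not (does A?)) ⇔ (¬ A)
T-not-does (yes a) = mk⇔ (λ ()) (λ ¬a → ¬a a)
T-not-does (no ¬a) = mk⇔ (const ¬a) (const tt)

minimal : ∀ {n r q} {_⊏_ : Rel (Fin n) r} → WellFounded _⊏_ → Decidable _⊏_ →
          {Q : Pred (Fin n) q} → Decidable₁ Q →
          ∀ {z} → Q z → ∃ λ m → Q m × ∀ w → Q w → ¬ w ⊏ m
minimal {_⊏_ = _⊏_} wf _⊏?_ {Q} Q? {z} = go (wf z)
  where
  go : ∀ {z} → Acc _⊏_ z → Q z → ∃ λ m → Q m × ∀ w → Q w → ¬ w ⊏ m
  go {z} (acc smaller) qz with any? (λ w → Q? w ×-dec (w ⊏? z))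
  ... | yes (w , qw , w⊏z) = go (smaller w⊏z) qw
  ... | no ¬lower          = z , qz , λ w qw w⊏z → ¬lower (w , qw , w⊏z)

sumOver : ∀ {A : Set} → (A → Bool) → (A → ℤ) → List A → ℤ
sumOver p f xs = sumℤ (map f (filterᵇ p xs))

module _ {A : Set} (p : A → Bool) (f : A → ℤ) where

  sumOver-accept : ∀ {x xs} → T (p x) → sumOver p f (x ∷ xs) ≡ f x + sumOver p f xs
  sumOver-accept px = cong (sumℤ ∘ map f) (filter-accept (T? ∘ p) px)

  sumOver-reject : ∀ {x xs} → ¬ T (p x) → sumOver p f (x ∷ xs) ≡ sumOver p f xs
  sumOver-reject ¬px = cong (sumℤ ∘ map f) (filter-reject (T? ∘ p) ¬px)

  sumOver-none : (∀ z → ¬ T (p z)) → ∀ xs → sumOver p f xs ≡ 0ℤ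
  sumOver-none none xs = cong (sumℤ ∘ map f) (filter-none (T? ∘ p) (All.universal none xs))

  sumOver-nonneg : (∀ z → T (p z) → 0ℤ ≤ f z) → ∀ xs → 0ℤ ≤ sumOver p f xs
  sumOver-nonneg nonneg []       = ≤-refl
  sumOver-nonneg nonneg (x ∷ xs) with p x | nonneg x
  ... | true  | 0≤fx = +-mono-≤ (0≤fx tt) (sumOver-nonneg nonneg xs)
  ... | false | _    = sumOver-nonneg nonneg xs

sumOver-cong : ∀ {A : Set} {p q : A → Bool} (f : A → ℤ) {xs} →
               All (λ z → p z ≡ q z) xs → sumOver p f xs ≡ sumOver q f xs
sumOver-cong f [] = refl
sumOver-cong {p = p} {q} f {x ∷ xs} (px≡qx ∷ eqs) with p x | q x
... | true  | true  = cong (_+_ (f x)) (sumOver-cong f eqs)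
... | false | false = sumOver-cong f eqs
... | true  | false = contradiction px≡qx λ ()
... | false | true  = contradiction px≡qx λ ()

module Removal {A : Set} (_≟_ : DecidableEquality A) where

  _without_ : (A → Bool) → A → A → Bool
  (p without k) z = p z ∧ not (does (z ≟ k))

  T-without : ∀ p {k z} → T ((p without k) z) ⇔ (T (p z) × z ≢ k)
  T-without p {k} {z} = ⇔-trans T-∧ (⇔-refl ×-⇔ T-not-does (z ≟ k))

  without-≢ : ∀ p {k z} → z ≢ k → (p without k) z ≡ p z
  without-≢ p {k} {z} z≢k with z ≟ k
  ... | yes z≡k = contradiction z≡k z≢k
  ... | no  _   = ∧-identityʳ (p z)

  sumOver-remove : ∀ p (f : A → ℤ) {k xs} → Unique xs → k ∈ xs → T (p k) →
                   sumOver p f xs ≡ f k + sumOver (p without k) f xs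
  sumOver-remove p f {k} {k ∷ xs} (k∉xs ∷ _) (here refl) pk = begin
    sumOver p f (k ∷ xs)                    ≡⟨ sumOver-accept p f pk ⟩
    f k + sumOver p f xs                    ≡⟨ cong (_+_ (f k)) (sumOver-cong f agree) ⟩
    f k + sumOver (p without k) f xs        ≡⟨ cong (_+_ (f k)) (sumOver-reject (p without k) f rejected) ⟨
    f k + sumOver (p without k) f (k ∷ xs)  ∎
    where
    open ≡-Reasoning
    agree : All (λ z → p z ≡ (p without k) z) xs
    agree = All.map (λ k≢z → sym (without-≢ p (k≢z ∘ sym))) k∉xs
    rejected : ¬ T ((p without k) k)
    rejected pk∖k = proj₂ (to (T-without p) pk∖k) refl
  sumOver-remove p f {k} {x ∷ xs} (x∉xs ∷ unique) (there k∈xs) pk with T? (p x)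
  ... | yes px = begin
    sumOver p f (x ∷ xs)                           ≡⟨ sumOver-accept p f px ⟩
    f x + sumOver p f xs                           ≡⟨ cong (_+_ (f x)) (sumOver-remove p f unique k∈xs pk) ⟩
    f x + (f k + sumOver (p without k) f xs)       ≡⟨ x∙yz≈y∙xz (f x) (f k) _ ⟩
    f k + (f x + sumOver (p without k) f xs)       ≡⟨ cong (_+_ (f k)) (sumOver-accept (p without k) f accepted) ⟨
    f k + sumOver (p without k) f (x ∷ xs)         ∎
    where
    open ≡-Reasoning
    accepted : T ((p without k) x)
    accepted = from (T-without p) (px , All.lookup x∉xs k∈xs)
  ... | no ¬px = begin
    sumOver p f (x ∷ xs)                    ≡⟨ sumOver-reject p f ¬px ⟩
    sumOver p f xs                          ≡⟨ sumOver-remove p f unique k∈xs pk ⟩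
    f k + sumOver (p without k) f xs        ≡⟨ cong (_+_ (f k)) (sumOver-reject (p without k) f rejected) ⟨
    f k + sumOver (p without k) f (x ∷ xs)  ∎
    where
    open ≡-Reasoning
    rejected : ¬ T ((p without k) x)
    rejected = ¬px ∘ proj₁ ∘ to (T-without p)

  length≤sumOver : ∀ p (f : A → ℤ) {xs ks} → (∀ z → T (p z) → 0ℤ ≤ f z) →
                   Unique xs → Unique ks → All (_∈ xs) ks → All (λ k → T (p k) × 1ℤ ≤ f k) ks →
                   + length ks ≤ sumOver p f xs
  length≤sumOver p f {xs} nonneg _ [] [] [] = sumOver-nonneg p f nonneg xs
  length≤sumOver p f {ks = k ∷ ks} nonneg unique (k∉ks ∷ uniqueₖ) (k∈xs ∷ ks⊆xs) ((pk , 1≤fk) ∷ large) =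
    subst (+ length (k ∷ ks) ≤_) (sym (sumOver-remove p f unique k∈xs pk))
      (+-mono-≤ 1≤fk (length≤sumOver (p without k) f (λ z → nonneg z ∘ proj₁ ∘ to (T-without p))
                        unique uniqueₖ ks⊆xs (All.zipWith keep (k∉ks , large))))
    where
    keep : ∀ {j} → k ≢ j × (T (p j) × 1ℤ ≤ f j) → T ((p without k) j) × 1ℤ ≤ f j
    keep (k≢j , pj , 1≤fj) = from (T-without p) (pj , k≢j ∘ sym) , 1≤fj

module _ {n : ℕ} (p : Fin n → Bool) (f : Fin n → ℤ) where
  open Removal (_≟ᶠ_ {n})

  length≤sumWhere : ∀ {ks} → (∀ z → T (p z) → 0ℤ ≤ f z) → Unique ks →
                    All (λ k → T (p k) × 1ℤ ≤ f k) ks → + length ks ≤ sumWhere p f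
  length≤sumWhere {ks} nonneg uniqueₖ =
    length≤sumOver p f nonneg (allFin⁺ n) uniqueₖ (All.universal ∈-allFin ks)

  sumWhere-singleton : ∀ {c} → T (p c) → (∀ z → T (p z) → z ≡ c) → sumWhere p f ≡ f c
  sumWhere-singleton {c} pc only = begin
    sumWhere p f                              ≡⟨ sumOver-remove p f (allFin⁺ n) (∈-allFin c) pc ⟩
    f c + sumOver (p without c) f (allFin n)  ≡⟨ cong (_+_ (f c)) (sumOver-none (p without c) f none (allFin n)) ⟩
    f c + 0ℤ                                  ≡⟨ +-identityʳ (f c) ⟩
    f c                                       ∎
    where
    open ≡-Reasoning
    none : ∀ z → ¬ T ((p without c) z)
    none z pz∖c = let (pz , z≢c) = to (T-without p {c} {z}) pz∖c in z≢c (only z pz)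

module DynkinProperties {m : ℕ} (Γ : Dynkin m) where
  open Dynkin Γ

  Adj-sym : ∀ {a b} → Adj a b → Adj b a
  Adj-sym {a} {b} (a≢b , θab<0) =
    a≢b ∘ sym , ≤∧≢⇒< (θ-off b a (a≢b ∘ sym)) (λ θba≡0 → <-irrefl (θ-zero b a θba≡0) θab<0)

  T-adjᵇ : ∀ {a b} → T (adjᵇ a b) ⇔ Adj a b
  T-adjᵇ {a} {b} = ⇔-trans T-∧ (T-not-does (a ≟ᶠ b) ×-⇔ T-does (θ a b <? 0ℤ))

module SimplyLacedProperties {m : ℕ} (Γ : Dynkin m) (simply-laced : SimplyLaced Γ) where
  open Dynkin Γ

  θ-off-values : ∀ {a b} → a ≢ b → θ a b ≡ -1ℤ ⊎ θ a b ≡ 0ℤ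
  θ-off-values {a} {b} a≢b with simply-laced a b
  ... | inj₁ θ≡-1        = inj₁ θ≡-1
  ... | inj₂ (inj₁ θ≡0)  = inj₂ θ≡0
  ... | inj₂ (inj₂ θ≡2)  = contradiction (subst (_≤ 0ℤ) θ≡2 (θ-off a b a≢b)) λ { (+≤+ ()) }

  -θ-nonneg : ∀ {a b} → a ≢ b → 0ℤ ≤ - θ a b
  -θ-nonneg a≢b with θ-off-values a≢b
  ... | inj₁ θ≡-1 rewrite θ≡-1 = +≤+ z≤n
  ... | inj₂ θ≡0  rewrite θ≡0  = ≤-refl

  -θ≤1 : ∀ {a b} → a ≢ b → - θ a b ≤ 1ℤ
  -θ≤1 a≢b with θ-off-values a≢b
  ... | inj₁ θ≡-1 rewrite θ≡-1 = ≤-refl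
  ... | inj₂ θ≡0  rewrite θ≡0  = +≤+ z≤n

  Adj⇒-θ≡1 : ∀ {a b} → Adj a b → - θ a b ≡ 1ℤ
  Adj⇒-θ≡1 (a≢b , θ<0) with θ-off-values a≢b
  ... | inj₁ θ≡-1 = cong -_ θ≡-1
  ... | inj₂ θ≡0  = contradiction θ<0 (<-irrefl θ≡0)

module FinPosetProperties {n : ℕ} (P : FinPoset n) where
  open FinPoset P
  open IsPartialOrder isPO using (antisym) renaming (refl to ≼-refl; trans to ≼-trans)

  ≺-trans : ∀ {x y z} → x ≺ y → y ≺ z → x ≺ z
  ≺-trans = ToStrict.<-trans _≡_ _≼_ isPO

  ≺-≼-trans : ∀ {x y z} → x ≺ y → y ≼ z → x ≺ z
  ≺-≼-trans = ToStrict.<-≤-trans _≡_ _≼_ sym ≼-trans antisym λ { refl y≼z → y≼z }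

  ≼-≺-trans : ∀ {x y z} → x ≼ y → y ≺ z → x ≺ z
  ≼-≺-trans = ToStrict.≤-<-trans _≡_ _≼_ ≼-trans antisym λ { refl x≼y → x≼y }

  _≺?_ : Decidable _≺_
  _≺?_ = ToStrict.<-decidable _≡_ _≼_ _≟ᶠ_ _≼?_

  ≼⇒≡⊎≺ : ∀ {x y} → x ≼ y → x ≡ y ⊎ x ≺ y
  ≼⇒≡⊎≺ {x} {y} x≼y with x ≟ᶠ y
  ... | yes x≡y = inj₁ x≡y
  ... | no  x≢y = inj₂ (x≼y , x≢y)

  T-≺ᵇ : ∀ {x y} → T (≺ᵇ x y) ⇔ x ≺ y
  T-≺ᵇ {x} {y} = ⇔-trans T-∧ (T-does (x ≼? y) ×-⇔ T-not-does (x ≟ᶠ y))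

  Between : Fin n → Fin n → Fin n → Set
  Between x z y = x ≺ z × z ≺ y

  ∃-cover-below : ∀ {x z} → x ≺ z → ∃ λ t → x ⋖ t × t ≼ z
  ∃-cover-below {x} {z} x≺z
    with minimal (po-wellFounded isPO) _≺?_ (λ t → (x ≺? t) ×-dec (t ≼? z)) (x≺z , ≼-refl)
  ... | t , (x≺t , t≼z) , least =
    t , (x≺t , λ s (x≺s , s≺t) → least s (x≺s , ≼-trans (proj₁ s≺t) t≼z) s≺t) , t≼z

  ∃-cover-above : ∀ {z y} → z ≺ y → ∃ λ s → z ≼ s × s ⋖ y
  ∃-cover-above {z} {y} z≺y
    with minimal (po-noetherian isPO) (flip _≺?_) (λ s → (z ≼? s) ×-dec (s ≺? y)) (≼-refl , z≺y)
  ... | s , (z≼s , s≺y) , greatest =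
    s , z≼s , (s≺y , λ t (s≺t , t≺y) → greatest t (≼-trans z≼s (proj₁ s≺t) , t≺y) s≺t)

  IsChain : Fin n → Fin n → Set
  IsChain x y = ∀ s t → x ≼ s × s ≼ y → x ≼ t × t ≼ y → Comparable s t

  IsChain-mono : ∀ {x y x′ y′} → x ≼ x′ → y′ ≼ y → IsChain x y → IsChain x′ y′
  IsChain-mono x≼x′ y′≼y chain s t (x′≼s , s≼y′) (x′≼t , t≼y′) =
    chain s t (≼-trans x≼x′ x′≼s , ≼-trans s≼y′ y′≼y) (≼-trans x≼x′ x′≼t , ≼-trans t≼y′ y′≼y)

  endpoint⊎interior : ∀ {x s y} → x ≼ s → s ≼ y → s ≡ x ⊎ s ≡ y ⊎ Between x s y
  endpoint⊎interior {x} {s} {y} x≼s s≼y with x ≟ᶠ s | s ≟ᶠ y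
  ... | yes x≡s | _       = inj₁ (sym x≡s)
  ... | no  _   | yes s≡y = inj₂ (inj₁ s≡y)
  ... | no  x≢s | no  s≢y = inj₂ (inj₂ ((x≼s , x≢s) , (s≼y , s≢y)))

  IsChain-from-interior : ∀ {x y a b} → (∀ z → Between x z y → a ≼ z × z ≼ b) →
                          IsChain a b → IsChain x y
  IsChain-from-interior inside chain s t (x≼s , s≼y) (x≼t , t≼y)
    with endpoint⊎interior x≼s s≼y | endpoint⊎interior x≼t t≼y
  ... | inj₁ refl        | _                = inj₁ x≼t
  ... | inj₂ (inj₁ refl) | _                = inj₂ t≼y
  ... | _                | inj₁ refl        = inj₂ x≼s
  ... | _                | inj₂ (inj₁ refl) = inj₁ s≼y
  ... | inj₂ (inj₂ x<s<y) | inj₂ (inj₂ x<t<y) = chain s t (inside s x<s<y) (inside t x<t<y)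

  chain-interior-cover² : ∀ {u c v z} → IsChain u v → u ⋖ c → c ⋖ v → Between u z v → z ≡ c
  chain-interior-cover² {c = c} {z = z} chain (u≺c , u⋖c) (c≺v , c⋖v) (u≺z , z≺v)
    with chain z c (proj₁ u≺z , proj₁ z≺v) (proj₁ u≺c , proj₁ c≺v)
  ... | inj₁ z≼c = [ id , (λ z≺c → contradiction (u≺z , z≺c) (u⋖c z)) ]′ (≼⇒≡⊎≺ z≼c)
  ... | inj₂ c≼z = [ sym , (λ c≺z → contradiction (c≺z , z≺v) (c⋖v z)) ]′ (≼⇒≡⊎≺ c≼z)

module ColoredDCompleteProperties {m n : ℕ} {Γ : Dynkin m} {P : FinPoset n}
                                  (D : ColoredDComplete Γ P) (simply-laced : SimplyLaced Γ) where
  open Dynkin Γ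
  open FinPoset P
  open ColoredDComplete D
  open IsPartialOrder isPO using () renaming (refl to ≼-refl; trans to ≼-trans)
  open DynkinProperties Γ
  open SimplyLacedProperties Γ simply-laced
  open FinPosetProperties P

  Consecutive : Fin n → Fin n → Set
  Consecutive x y = x ≺ y × κ x ≡ κ y × (∀ z → κ z ≡ κ x → ¬ Between x z y)

  ∃-consecutive : ∀ {u v} → u ≺ v → κ u ≡ κ v → ∃ λ w → Consecutive u w × w ≼ v
  ∃-consecutive {u} {v} u≺v κu≡κv
    with minimal (po-wellFounded isPO) _≺?_ (λ w → (u ≺? w) ×-dec ((κ w ≟ᶠ κ u) ×-dec (w ≼? v)))
                 (u≺v , sym κu≡κv , ≼-refl)
  ... | w , (u≺w , κw≡κu , w≼v) , least =
    w , (u≺w , sym κw≡κu , λ z κz≡κu (u≺z , z≺w) → least z (u≺z , κz≡κu , ≼-trans (proj₁ z≺w) w≼v) z≺w)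
      , w≼v

  adjacent≤weight : ∀ (p : Fin n → Bool) b {zs} → (∀ z → T (p z) → κ z ≢ b) → Unique zs →
                    All (λ z → T (p z) × Adj (κ z) b) zs → + length zs ≤ sumWhere p (λ z → - θ (κ z) b)
  adjacent≤weight p b colours unique adjacent =
    length≤sumWhere p _ (λ z pz → -θ-nonneg (colours z pz)) unique
      (All.map (λ (pz , adj) → pz , ≤-reflexive (sym (Adj⇒-θ≡1 adj))) adjacent)

  module Interior {x y : Fin n} (consecutive : Consecutive x y) where
    interior : Fin n → Bool
    interior z = ≺ᵇ x z ∧ ≺ᵇ z y

    T-interior : ∀ {z} → T (interior z) ⇔ Between x z y
    T-interior = ⇔-trans T-∧ (T-≺ᵇ ×-⇔ T-≺ᵇ)

    interior-colour : ∀ {z} → Between x z y → κ z ≢ κ x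
    interior-colour {z} x<z<y κz≡κx = proj₂ (proj₂ consecutive) z κz≡κx x<z<y

    interior-weight : sumWhere interior (λ z → - θ (κ z) (κ x)) ≡ + 2
    interior-weight = ICE2 x y (κ x) refl (sym (proj₁ (proj₂ consecutive))) (proj₁ consecutive)
                        (proj₂ (proj₂ consecutive))

    interior-not-singleton : ∀ {c} → Between x c y → ¬ (∀ z → Between x z y → z ≡ c)
    interior-not-singleton {c} x<c<y only =
      contradiction (subst (_≤ 1ℤ) weight≡2 (-θ≤1 (interior-colour x<c<y))) λ { (+≤+ (s≤s ())) }
      where
      weight≡2 : - θ (κ c) (κ x) ≡ + 2
      weight≡2 = trans (sym (sumWhere-singleton interior _ (from T-interior x<c<y)
                                (λ z → only z ∘ to T-interior)))
                       interior-weight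

    adjacent-interior≤2 : ∀ {zs} → Unique zs → All (λ z → Between x z y × Adj (κ z) (κ x)) zs →
                          length zs ≤ℕ 2
    adjacent-interior≤2 unique adjacent =
      drop‿+≤+ (subst (_ ≤_) interior-weight
        (adjacent≤weight interior (κ x) (λ z → interior-colour ∘ to T-interior) unique
          (All.map (λ (x<z<y , adj) → from T-interior x<z<y , adj) adjacent)))

  adjacent-above-maximal≤1 : ∀ {x ys} → (∀ y → κ y ≡ κ x → ¬ x ≺ y) → Unique ys →
                             All (λ y → x ≺ y × Adj (κ y) (κ x)) ys → length ys ≤ℕ 1
  adjacent-above-maximal≤1 {x} maximal unique adjacent =
    drop‿+≤+ (≤-trans
      (adjacent≤weight above (κ x) (λ y → proj₁ ∘ proj₂ ∘ to T-above) unique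
        (All.map (λ (x≺y , adj) → from T-above (x≺y , adj) , adj) adjacent))
      (UCB1 x (κ x) refl maximal))
    where
    above : Fin n → Bool
    above y = ≺ᵇ x y ∧ adjᵇ (κ y) (κ x)

    T-above : ∀ {y} → T (above y) ⇔ (x ≺ y × Adj (κ y) (κ x))
    T-above = ⇔-trans T-∧ (T-≺ᵇ ×-⇔ T-adjᵇ)

  ∃-consecutive-above : ∀ {x y₁ y₂} → x ≺ y₁ → x ≺ y₂ → y₁ ≢ y₂ →
                        Adj (κ y₁) (κ x) → Adj (κ y₂) (κ x) → ∃ λ w → Consecutive x w
  ∃-consecutive-above {x} x≺y₁ x≺y₂ y₁≢y₂ adj₁ adj₂ with any? (λ w → (x ≺? w) ×-dec (κ x ≟ᶠ κ w))
  ... | yes (w , x≺w , κx≡κw) = map₂ proj₁ (∃-consecutive x≺w κx≡κw)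
  ... | no  ¬above = contradiction
        (adjacent-above-maximal≤1 (λ w κw≡κx x≺w → ¬above (w , x≺w , sym κw≡κx))
           ((y₁≢y₂ ∷ []) ∷ [] ∷ []) ((x≺y₁ , adj₁) ∷ (x≺y₂ , adj₂) ∷ []))
        λ { (s≤s ()) }

  squeeze : ∀ {c c₂ v w z} → Consecutive c w → c ⋖ c₂ → c₂ ≺ v → v ≺ w → Adj (κ v) (κ c) →
            Between c z w → c₂ ≼ z × z ≼ v
  squeeze {c} {c₂} {v} {w} {z} consecutive@(_ , κc≡κw , _) c⋖c₂@(c≺c₂ , _) c₂≺v v≺w adj-v (c≺z , z≺w) =
    lower , upper
    where
    open Interior consecutive

    c≺v : c ≺ v
    c≺v = ≺-trans c≺c₂ c₂≺v

    adj-c₂ : Adj (κ c₂) (κ c)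
    adj-c₂ = Adj-sym (NA c c₂ c⋖c₂)

    adjacent-is-c₂-or-v : ∀ {t} → Between c t w → Adj (κ t) (κ c) → t ≡ c₂ ⊎ t ≡ v
    adjacent-is-c₂-or-v {t} c<t<w adj-t with t ≟ᶠ c₂ | t ≟ᶠ v
    ... | yes t≡c₂ | _       = inj₁ t≡c₂
    ... | no  _    | yes t≡v = inj₂ t≡v
    ... | no  t≢c₂ | no  t≢v = contradiction
          (adjacent-interior≤2 ((proj₂ c₂≺v ∷ (t≢c₂ ∘ sym) ∷ []) ∷ ((t≢v ∘ sym) ∷ []) ∷ [] ∷ [])
             (((c≺c₂ , ≺-trans c₂≺v v≺w) , adj-c₂) ∷ ((c≺v , v≺w) , adj-v) ∷ (c<t<w , adj-t) ∷ []))
          λ { (s≤s (s≤s ())) }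

    lower : c₂ ≼ z
    lower with ∃-cover-below c≺z
    ... | t , c⋖t , t≼z with adjacent-is-c₂-or-v (proj₁ c⋖t , ≼-≺-trans t≼z z≺w) (Adj-sym (NA c t c⋖t))
    ...   | inj₁ refl = t≼z
    ...   | inj₂ refl = contradiction (c≺c₂ , c₂≺v) (proj₂ c⋖t c₂)

    upper : z ≼ v
    upper with ∃-cover-above z≺w
    ... | s , z≼s , s⋖w with adjacent-is-c₂-or-v (≺-≼-trans c≺z z≼s , proj₁ s⋖w)
                              (subst (Adj (κ s)) (sym κc≡κw) (NA s w s⋖w))
    ...   | inj₁ refl = ≼-trans z≼s (proj₁ c₂≺v)
    ...   | inj₂ refl = z≼s

  ColoursDistinctAbove : Fin n → Set
  ColoursDistinctAbove u = ∀ {c w} → u ≺ c → c ≺ w → IsChain c w → κ c ≢ κ w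

  ¬consecutive-⋖ : ∀ {u v} → Consecutive u v → ¬ u ⋖ v
  ¬consecutive-⋖ {u} {v} (_ , κu≡κv , _) u⋖v = proj₁ (NA u v u⋖v) κu≡κv

  ¬consecutive-chain-⋖⋖ : ∀ {u c v} → Consecutive u v → IsChain u v → u ⋖ c → c ⋖ v → ⊥
  ¬consecutive-chain-⋖⋖ consecutive chain u⋖c c⋖v =
    interior-not-singleton (proj₁ u⋖c , proj₁ c⋖v) (λ z → chain-interior-cover² chain u⋖c c⋖v)
    where open Interior consecutive

  ¬consecutive-chain-⋖⋖≺ : ∀ {u c c₂ v} → ColoursDistinctAbove u → Consecutive u v → IsChain u v →
                            u ⋖ c → c ⋖ c₂ → c₂ ≺ v → ⊥
  ¬consecutive-chain-⋖⋖≺ {u} {c} {c₂} {v} distinct-above (_ , κu≡κv , _) chain u⋖c@(u≺c , _) c⋖c₂ c₂≺v =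
    uncurry compare-with-v
      (∃-consecutive-above (≺-trans (proj₁ c⋖c₂) c₂≺v) (proj₁ c⋖c₂) (proj₂ c₂≺v ∘ sym) adj-v
                           (Adj-sym (NA c c₂ c⋖c₂)))
    where
    adj-v : Adj (κ v) (κ c)
    adj-v = subst (λ a → Adj a (κ c)) κu≡κv (NA u c u⋖c)

    interior-in-[u,v] : ∀ {w} → Consecutive c w → v ≺ w → ∀ z → Between c z w → u ≼ z × z ≼ v
    interior-in-[u,v] consecutive v≺w z c<z<w =
      let (c₂≼z , z≼v) = squeeze consecutive c⋖c₂ c₂≺v v≺w adj-v c<z<w
      in ≼-trans (proj₁ (≺-trans u≺c (proj₁ c⋖c₂))) c₂≼z , z≼v

    compare-with-v : ∀ w → Consecutive c w → ⊥
    compare-with-v w consecutive@(c≺w , κc≡κw , _)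
      with AC w v (subst (λ b → Adj b (κ v)) κc≡κw (Adj-sym adj-v))
    ... | inj₁ w≼v = [ (λ { refl → proj₁ adj-v (sym κc≡κw) })
                     , (λ w≺v → distinct-above u≺c c≺w
                                  (IsChain-mono (proj₁ u≺c) (proj₁ w≺v) chain) κc≡κw)
                     ]′ (≼⇒≡⊎≺ w≼v)
    ... | inj₂ v≼w = [ (λ { refl → proj₁ adj-v (sym κc≡κw) })
                     , (λ v≺w → distinct-above u≺c c≺w
                                  (IsChain-from-interior (interior-in-[u,v] consecutive v≺w) chain) κc≡κw)
                     ]′ (≼⇒≡⊎≺ v≼w)

  ¬consecutive-chain : ∀ {u v} → ColoursDistinctAbove u → Consecutive u v → ¬ IsChain u v
  ¬consecutive-chain distinct-above consecutive@(u≺v , _) chain with ∃-cover-below u≺v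
  ... | c , u⋖c , c≼v with ≼⇒≡⊎≺ c≼v
  ...   | inj₁ refl = ¬consecutive-⋖ consecutive u⋖c
  ...   | inj₂ c≺v with ∃-cover-below c≺v
  ...     | c₂ , c⋖c₂ , c₂≼v with ≼⇒≡⊎≺ c₂≼v
  ...       | inj₁ refl = ¬consecutive-chain-⋖⋖ consecutive chain u⋖c c⋖c₂
  ...       | inj₂ c₂≺v = ¬consecutive-chain-⋖⋖≺ distinct-above consecutive chain u⋖c c⋖c₂ c₂≺v

  chain-colours-distinct : ∀ {u v} → u ≺ v → IsChain u v → κ u ≢ κ v
  chain-colours-distinct {u} = go (po-noetherian isPO u)
    where
    go : ∀ {u v} → Acc (flip _≺_) u → u ≺ v → IsChain u v → κ u ≢ κ v
    go (acc above) u≺v chain κu≡κv =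
      let (w , consecutive , w≼v) = ∃-consecutive u≺v κu≡κv
      in ¬consecutive-chain (go ∘ above) consecutive (IsChain-mono ≼-refl w≼v chain)

  chain-colouring-injective : ∀ {x y u v} → IsChain x y → x ≼ u × u ≼ y → x ≼ v × v ≼ y →
                              u ≢ v → κ u ≢ κ v
  chain-colouring-injective chain (x≼u , u≼y) (x≼v , v≼y) u≢v with chain _ _ (x≼u , u≼y) (x≼v , v≼y)
  ... | inj₁ u≼v = chain-colours-distinct (u≼v , u≢v) (IsChain-mono x≼u v≼y chain)
  ... | inj₂ v≼u = chain-colours-distinct (v≼u , u≢v ∘ sym) (IsChain-mono x≼v u≼y chain) ∘ sym

lemma4p1 : ∀ {m n} (Γ : Dynkin m) (P : FinPoset n) (D : ColoredDComplete Γ P) →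
    SimplyLaced Γ →
    ∀ (x y : Fin n) → FinPoset._≺_ P x y →
    (∀ u v → (FinPoset._≼_ P x u × FinPoset._≼_ P u y) → (FinPoset._≼_ P x v × FinPoset._≼_ P v y) →
      FinPoset.Comparable P u v) →
    ∀ u v → (FinPoset._≼_ P x u × FinPoset._≼_ P u y) → (FinPoset._≼_ P x v × FinPoset._≼_ P v y) →
      u ≢ v → ColoredDComplete.κ D u ≢ ColoredDComplete.κ D v
lemma4p1 Γ P D simply-laced x y _ chain u v = chain-colouring-injective chain
  where open ColoredDCompleteProperties D simply-laced
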